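{- Let $\lambda,\mu,q\ge 0$ and let $G$ be a graph satisfying the $(\lambda,\mu)$-bow metric in which every metric triangle has all sides of length at most $q$. Then the hyperbolicity $\delta$ and the slimness $\varsigma$ of $G$ satisfy $\delta\le\min\{\tfrac12\max\{\mu,q+2\lambda\}+2q,\ 4\max\{\mu,q+2\lambda\}+q+\tfrac12\}$ and $\varsigma\le\min\{\tfrac32\max\{\mu,q+2\lambda\}+6q+\tfrac12,\ 2\max\{\mu,q+2\lambda\}+\tfrac q2\}$.
   Context: All graphs are finite, simple, unweighted, undirected and connected, with shortest-path distance $d$. The interval is $I(u,v)=\{z: d(u,z)+d(z,v)=d(u,v)\}$. Three vertices $x,y,z$ form a metric triangle if the intervals $I(x,y),I(y,z),I(x,z)$ pairwise intersect only in their common endpoints; its sides have lengths $d(x,y),d(y,z),d(z,x)$. A graph satisfies the $(\lambda,\mu)$-bow metric if for all vertices $u,v,w,x$ with $v\in I(u,w)$, $w\in I(v,x)$ and $d(v,w)>\lambda$, one has $d(u,x)\ge d(u,v)+d(v,w)+d(w,x)-\mu$. $G$ is $\delta$-hyperbolic if for any four vertices the two largest of the sums $d(u,v)+d(w,x)$, $d(u,w)+d(v,x)$, $d(u,x)+d(v,w)$ differ by at most $2\delta$; the hyperbolicity is the least such $\delta$. A geodesic triangle (union of shortest paths $P(u,v),P(v,w),P(w,u)$) is $\varsigma$-slim if every vertex of each side is within distance $\varsigma$ of the union of the other two sides; the slimness is the least $\varsigma$ such that all geodesic triangles are $\varsigma$-slim. -}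

module Defs where

open import Data.Nat using (ℕ; zero; suc; _+_; _*_; _≤_; _<_; _⊔_; _⊓_)
open import Data.Fin using (Fin; fromℕ; inject₁)
open import Data.Product using (Σ; _×_; ∃-syntax)
open import Data.Sum using (_⊎_)
open import Relation.Binary.PropositionalEquality using (_≡_)
open import Relation.Nullary using (¬_)

record Graph : Set₁ where
  field
    n     : ℕ
    Adj   : Fin n → Fin n → Set
    sym   : ∀ {u v} → Adj u v → Adj v u
    irrefl : ∀ {u} → ¬ Adj u u

module _ (G : Graph) where
  open Graph G

  V : Set
  V = Fin n

  record Walk (u v : V) (k : ℕ) : Set where
    field
      vtx   : Fin (suc k) → V
      start : vtx Fin.zero ≡ u
      end   : vtx (fromℕ k) ≡ v
      step  : (i : Fin k) → Adj (vtx (inject₁ i)) (vtx (Fin.suc i))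

  Connected : Set
  Connected = ∀ u v → ∃[ k ] Walk u v k

  IsShortestPathDist : (V → V → ℕ) → Set
  IsShortestPathDist d = ∀ u v → Walk u v (d u v) × (∀ k → Walk u v k → d u v ≤ k)

  module _ (d : V → V → ℕ) where

    InInterval : V → V → V → Set
    InInterval u v z = d u z + d z v ≡ d u v

    MetricTriangle : V → V → V → Set
    MetricTriangle x y z =
      (∀ t → InInterval x y t → InInterval x z t → t ≡ x) ×
      (∀ t → InInterval y x t → InInterval y z t → t ≡ y) ×
      (∀ t → InInterval z x t → InInterval z y t → t ≡ z)

    MetricTrianglesBounded : ℕ → Set
    MetricTrianglesBounded q = ∀ x y z → MetricTriangle x y z →
      d x y ≤ q × d y z ≤ q × d z x ≤ q

    BowMetric : ℕ → ℕ → Set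
    BowMetric λ' μ = ∀ u v w x → InInterval u w v → InInterval v x w → λ' < d v w →
      d u v + d v w + d w x ≤ d u x + μ

    -- G is δ-hyperbolic with 2δ = t: the largest of the three sums exceeds the
    -- maximum of the other two (= the second largest) by at most t.
    HyperbolicTwice : ℕ → Set
    HyperbolicTwice t = ∀ u v w x →
      let s₁ = d u v + d w x
          s₂ = d u w + d v x
          s₃ = d u x + d v w
      in (s₁ ≤ (s₂ ⊔ s₃) + t) × (s₂ ≤ (s₁ ⊔ s₃) + t) × (s₃ ≤ (s₁ ⊔ s₂) + t)

    Geodesic : V → V → Set
    Geodesic u v = Walk u v (d u v)

    OnPath : ∀ {u v} → Geodesic u v → V → Set
    OnPath {u} {v} P y = ∃[ i ] Walk.vtx P i ≡ y

    SideCloseTwice : ℕ → ∀ {a b c e f g} → Geodesic a b → Geodesic c e → Geodesic f g → Set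
    SideCloseTwice t P Q R = ∀ i → ∃[ y ] ((OnPath Q y ⊎ OnPath R y) × 2 * d (Walk.vtx P i) y ≤ t)

    -- all geodesic triangles are ς-slim, where 2ς ≤ t (ς = t/2)
    SlimTwice : ℕ → Set
    SlimTwice t = ∀ u v w (P : Geodesic u v) (Q : Geodesic v w) (R : Geodesic w u) →
      SideCloseTwice t P Q R × SideCloseTwice t Q R P × SideCloseTwice t R P Q

{-# OPTIONS --safe #-}
-- Every triple x, y, z has a quasi-median: taking x' ∈ I(x,y) ∩ I(x,z) farthest from x, then
-- y' ∈ I(y,x') ∩ I(y,z) farthest from y and z' ∈ I(z,x') ∩ I(z,y') farthest from z, gives a
-- metric triangle x'y'z' with d(x,y) = d(x,x') + d(x',y') + d(y',y) and likewise for the other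
-- pairs, so its sides are at most q.
-- With M = max(μ, q + 2λ), two vertices p, p' of an interval I(w,x) at the same distance from w
-- are within M: in the quasi-median of p, p', w either a corner is farther than λ from p (or p'),
-- and the bow metric applied through that corner towards x gives d(p,p') ≤ μ, or both corners
-- are λ-close to p and p', and d(p,p') ≤ 2λ + q.
-- Comparing the quasi-medians of u, w, x and of v, w, x by this fact gives the four-point
-- condition with 2δ ≤ M + 2q. Likewise every vertex of I(u,v) is within (M + 2q)/2 of a vertex
-- of I(v,w) ∪ I(w,u), which is within M of the geodesic side joining the ends of its interval,
-- so 2ς ≤ 3M + 2q.
-- Since q ≤ M, both bounds are below the stated ones.

module Submission where

open import Defs
open import Data.Nat using (ℕ; zero; suc; _+_; _*_; _⊔_; _⊓_; _≤_; _<_; z≤n; s≤s; _≟_; _<?_)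
open import Data.Nat.Properties
open import Data.Nat.Tactic.RingSolver using (solve-∀)
open import Data.Fin using (Fin; zero; suc; toℕ; fromℕ<; inject₁)
open import Data.Fin.Properties using (toℕ-fromℕ<)
open import Data.List using (List; filter; allFin)
open import Data.List.Extrema.Nat using (argmax; argmax-all; f[xs]≤f[argmax])
open import Data.List.Membership.Propositional.Properties using (∈-filter⁺; ∈-allFin)
open import Data.List.Relation.Unary.All using (lookup)
open import Data.List.Relation.Unary.All.Properties using (all-filter)
open import Data.Product using (_×_; _,_; proj₁; proj₂; ∃-syntax)
open import Data.Sum using (_⊎_; inj₁; inj₂)
open import Function.Metric.Nat using (IsMetric)
open import Relation.Nullary using (Dec; yes; no)
open import Relation.Nullary.Decidable using (_×-dec_)
open import Relation.Unary using (Pred; Decidable)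
open import Relation.Binary.PropositionalEquality
  using (_≡_; refl; sym; trans; cong; cong₂; subst; subst₂; isEquivalence; module ≡-Reasoning)

module _ {G : Graph} where
  open Graph G using (Adj)
  open Walk

  walk-[] : ∀ a → Walk G a a 0
  walk-[] a = record { vtx = λ _ → a ; start = refl ; end = refl ; step = λ () }

  walk-∷ : ∀ {a a' b k} → Adj a a' → Walk G a' b k → Walk G a b (suc k)
  walk-∷ {a} {k = k} adj w = record { vtx = vtx′ ; start = refl ; end = end w ; step = step′ }
    where
    vtx′ : Fin (suc (suc k)) → V G
    vtx′ zero    = a
    vtx′ (suc i) = vtx w i
    step′ : ∀ i → Adj (vtx′ (inject₁ i)) (vtx′ (suc i))
    step′ zero    = subst (Adj a) (sym (start w)) adj
    step′ (suc i) = step w i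

  walk-tail : ∀ {a b k} (w : Walk G a b (suc k)) → Walk G (vtx w (suc zero)) b k
  walk-tail w =
    record { vtx = λ i → vtx w (suc i) ; start = refl ; end = end w ; step = λ i → step w (suc i) }

  walk-head : ∀ {a b k} (w : Walk G a b (suc k)) → Adj a (vtx w (suc zero))
  walk-head w = subst (λ a → Adj a _) (start w) (step w zero)

  walk₀⇒≡ : ∀ {a b} → Walk G a b 0 → a ≡ b
  walk₀⇒≡ w = trans (sym (start w)) (end w)

module _ (G : Graph) (d : V G → V G → ℕ) where

  HyperbolicTwice-mono : ∀ {s t} → s ≤ t → HyperbolicTwice G d s → HyperbolicTwice G d t
  HyperbolicTwice-mono {s} {t} s≤t hyp u v w x =
    let h₁ , h₂ , h₃ = hyp u v w x in weaken h₁ , weaken h₂ , weaken h₃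
    where
    weaken : ∀ {m n} → m ≤ n + s → m ≤ n + t
    weaken m≤n+s = ≤-trans m≤n+s (+-monoʳ-≤ _ s≤t)

  SlimTwice-mono : ∀ {s t} → s ≤ t → SlimTwice G d s → SlimTwice G d t
  SlimTwice-mono {s} {t} s≤t slim u v w P Q R =
    let c₁ , c₂ , c₃ = slim u v w P Q R in weaken P Q R c₁ , weaken Q R P c₂ , weaken R P Q c₃
    where
    weaken : ∀ {a b c e f g} (P : Geodesic G d a b) (Q : Geodesic G d c e) (R : Geodesic G d f g) →
             SideCloseTwice G d s P Q R → SideCloseTwice G d t P Q R
    weaken _ _ _ close i = let y , y∈Q∪R , near = close i in y , y∈Q∪R , ≤-trans near s≤t

  four-point⇒HyperbolicTwice : (∀ a b → d a b ≡ d b a) → ∀ {t} →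
    (∀ u v w x → d u v + d w x ≤ (d u w + d v x) ⊔ (d u x + d v w) + t) → HyperbolicTwice G d t
  four-point⇒HyperbolicTwice d-sym {t} four u v w x = four u v w x , second , third
    where
    second : d u w + d v x ≤ (d u v + d w x) ⊔ (d u x + d v w) + t
    second = subst (λ s → d u w + d v x ≤ (d u v + d w x) ⊔ (d u x + s) + t) (d-sym w v) (four u w v x)
    third : d u x + d v w ≤ (d u v + d w x) ⊔ (d u w + d v x) + t
    third = subst₂ (λ s s' → d u x + d v w ≤ (d u v + s) ⊔ (d u w + s') + t)
                   (d-sym x w) (d-sym x v) (four u x v w)

module ShortestPath (G : Graph) (d : V G → V G → ℕ) (sp : IsShortestPathDist G d) where
  open Graph G using (Adj) renaming (sym to Adj-sym)
  open Walk using (vtx)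
  open ≤-Reasoning

  geodesic : ∀ a b → Geodesic G d a b
  geodesic a b = proj₁ (sp a b)

  d≤length : ∀ {a b k} → Walk G a b k → d a b ≤ k
  d≤length = proj₂ (sp _ _) _

  d-refl : ∀ a → d a a ≡ 0
  d-refl a = n≤0⇒n≡0 (d≤length (walk-[] a))

  d≡0⇒≡ : ∀ {a b} → d a b ≡ 0 → a ≡ b
  d≡0⇒≡ {a} {b} ab≡0 = walk₀⇒≡ (subst (Walk G a b) ab≡0 (geodesic a b))

  d-adj : ∀ {a a'} c → Adj a a' → d a c ≤ suc (d a' c)
  d-adj c adj = d≤length (walk-∷ adj (geodesic _ c))

  d-adj≤1 : ∀ {a b} → Adj a b → d a b ≤ 1
  d-adj≤1 {a} {b} adj = subst (λ n → d a b ≤ suc n) (d-refl b) (d-adj b adj)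

  d≤length+d : ∀ {a b k} c → Walk G a b k → d a c ≤ k + d b c
  d≤length+d {k = zero}  c w rewrite walk₀⇒≡ w = ≤-refl
  d≤length+d {k = suc k} c w = ≤-trans (d-adj c (walk-head w)) (s≤s (d≤length+d c (walk-tail w)))

  d-triangle : ∀ a b c → d a c ≤ d a b + d b c
  d-triangle a b c = d≤length+d c (geodesic a b)

  d-reverse≤length : ∀ {a b k} → Walk G a b k → d b a ≤ k
  d-reverse≤length {k = zero} w rewrite walk₀⇒≡ w = ≤-reflexive (d-refl _)
  d-reverse≤length {a} {b} {suc k} w = begin
    d b a            ≤⟨ d-triangle b a' a ⟩
    d b a' + d a' a  ≤⟨ +-mono-≤ (d-reverse≤length (walk-tail w)) (d-adj≤1 (Adj-sym (walk-head w))) ⟩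
    k + 1            ≡⟨ +-comm k 1 ⟩
    suc k            ∎
    where
    a' : V G
    a' = vtx w (suc zero)

  d-sym : ∀ a b → d a b ≡ d b a
  d-sym a b = ≤-antisym (d-reverse≤length (geodesic b a)) (d-reverse≤length (geodesic a b))

  isMetric : IsMetric _≡_ d
  isMetric = record
    { isSemiMetric = record
      { isQuasiSemiMetric = record
        { isPreMetric = record
          { isProtoMetric = record
            { isPartialOrder  = ≤-isPartialOrder
            ; ≈-isEquivalence = isEquivalence
            ; cong            = cong₂ d
            ; nonNegative     = z≤n
            }
          ; ≈⇒0 = λ { refl → d-refl _ }
          }
        ; 0⇒≈ = d≡0⇒≡
        }
      ; sym = d-sym
      }
    ; triangle = d-triangle
    }

  walk-prefix : ∀ {a b k} (w : Walk G a b k) i → d a (vtx w i) ≤ toℕ i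
  walk-prefix w zero rewrite Walk.start w = ≤-reflexive (d-refl _)
  walk-prefix {k = suc k} w (suc i) = ≤-trans (d-adj _ (walk-head w)) (s≤s (walk-prefix (walk-tail w) i))

  walk-suffix : ∀ {a b k} (w : Walk G a b k) i → toℕ i + d (vtx w i) b ≤ k
  walk-suffix w zero rewrite Walk.start w = d≤length w
  walk-suffix {k = suc k} w (suc i) = s≤s (walk-suffix (walk-tail w) i)

  geodesic-vertex : ∀ {a b} (P : Geodesic G d a b) i →
                    d a (vtx P i) ≡ toℕ i × InInterval G d a b (vtx P i)
  geodesic-vertex {a} {b} P i = ay≡i , y∈I
    where
    y : V G
    y = vtx P i
    y∈I : d a y + d y b ≡ d a b
    y∈I = ≤-antisym (≤-trans (+-monoˡ-≤ (d y b) (walk-prefix P i)) (walk-suffix P i)) (d-triangle a y b)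
    ay≡i : d a y ≡ toℕ i
    ay≡i = ≤-antisym (walk-prefix P i)
                     (+-cancelʳ-≤ (d y b) _ _ (≤-trans (walk-suffix P i) (≤-reflexive (sym y∈I))))

  geodesic-point : ∀ {a b j} (P : Geodesic G d a b) → j ≤ d a b →
                   ∃[ y ] OnPath G d P y × d a y ≡ j × InInterval G d a b y
  geodesic-point {a} {b} P j≤ab =
    let ay≡i , y∈I = geodesic-vertex P i
    in vtx P i , (i , refl) , trans ay≡i (toℕ-fromℕ< (s≤s j≤ab)) , y∈I
    where
    i : Fin (suc (d a b))
    i = fromℕ< (s≤s j≤ab)

module Intervals {ℓ} {A : Set ℓ} {d : A → A → ℕ} (isMetric : IsMetric _≡_ d) where
  open IsMetric isMetric using (triangle) renaming (sym to d-sym; ≈⇒0 to ≡⇒d≡0; 0⇒≈ to d≡0⇒≡)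

  I : A → A → A → Set
  I u v z = d u z + d z v ≡ d u v

  I-start : ∀ u v → I u v u
  I-start u v = cong (_+ d u v) (≡⇒d≡0 refl)

  I-sym : ∀ {u v z} → I u v z → I v u z
  I-sym {u} {v} {z} z∈I = begin
    d v z + d z u  ≡⟨ +-comm (d v z) (d z u) ⟩
    d z u + d v z  ≡⟨ cong₂ _+_ (d-sym z u) (d-sym v z) ⟩
    d u z + d z v  ≡⟨ z∈I ⟩
    d u v          ≡⟨ d-sym u v ⟩
    d v u          ∎
    where open ≡-Reasoning

  I⇒≤ : ∀ {u v z} → I u v z → d u z ≤ d u v
  I⇒≤ {u} {v} {z} z∈I = subst (d u z ≤_) z∈I (m≤m+n (d u z) (d z v))

  split⇒I : ∀ {a b c e} → d a b ≡ d a c + d c e + d e b → I a e c × I a b e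
  split⇒I {a} {b} {c} {e} split = c∈I , e∈I
    where
    e∈I : I a b e
    e∈I = ≤-antisym (≤-trans (+-monoˡ-≤ (d e b) (triangle a c e)) (≤-reflexive (sym split))) (triangle a e b)
    c∈I : I a e c
    c∈I = +-cancelʳ-≡ (d e b) _ _ (trans (sym split) (sym e∈I))

  I-chain : ∀ {s e a b} → I s e a → I a e b → d s e ≡ d s a + d a b + d b e
  I-chain {s} {e} {a} {b} a∈I b∈I = begin
    d s e                  ≡⟨ sym a∈I ⟩
    d s a + d a e          ≡⟨ cong (d s a +_) (sym b∈I) ⟩
    d s a + (d a b + d b e) ≡⟨ sym (+-assoc (d s a) (d a b) (d b e)) ⟩
    d s a + d a b + d b e  ∎
    where open ≡-Reasoning

  I-trans : ∀ {s e a b} → I s e a → I a e b → I s b a × I s e b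
  I-trans a∈I b∈I = split⇒I (I-chain a∈I b∈I)

  I-⊆ : ∀ {a b c e} → I a b e → I a e c → I a b c
  I-⊆ e∈I c∈I = I-sym (proj₂ (I-trans (I-sym e∈I) (I-sym c∈I)))

  I-level : ∀ {w x p p'} → I w x p → I w x p' → d w p ≡ d w p' → d x p ≡ d x p'
  I-level {w} {x} {p} {p'} p∈I p'∈I same = begin
    d x p   ≡⟨ d-sym x p ⟩
    d p x   ≡⟨ +-cancelˡ-≡ (d w p) _ _ (trans p∈I (trans (sym p'∈I) (cong (_+ d p' x) (sym same)))) ⟩
    d p' x  ≡⟨ d-sym p' x ⟩
    d x p'  ∎
    where open ≡-Reasoning

  I-antisym : ∀ {a c t} → I a t c → d a t ≤ d a c → t ≡ c
  I-antisym {a} {c} {t} c∈I at≤ac = sym (d≡0⇒≡ (n≤0⇒n≡0 (+-cancelˡ-≤ (d a c) _ _ ac+ct≤ac+0)))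
    where
    ac+ct≤ac+0 : d a c + d c t ≤ d a c + 0
    ac+ct≤ac+0 = subst₂ _≤_ (sym c∈I) (sym (+-identityʳ (d a c))) at≤ac

  farthest-isolated : ∀ {a b₁ b₂ c} → I a b₁ c → I a b₂ c →
    (∀ t → I a b₁ t → I a b₂ t → d a t ≤ d a c) →
    ∀ t → I c b₁ t → I c b₂ t → t ≡ c
  farthest-isolated c∈I₁ c∈I₂ farthest t t∈I₁ t∈I₂ =
    let c∈I[a,t] , t∈I[a,b₁] = I-trans c∈I₁ t∈I₁
    in I-antisym c∈I[a,t] (farthest t t∈I[a,b₁] (proj₂ (I-trans c∈I₂ t∈I₂)))

maximiser : ∀ {n p} {P : Pred (Fin n) p} → Decidable P → (f : Fin n → ℕ) →
            ∀ {a} → P a → ∃[ b ] P b × (∀ t → P t → f t ≤ f b)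
maximiser {n} P? f {a} Pa =
  argmax f a xs , argmax-all f Pa (all-filter P? (allFin n)) ,
  λ t Pt → lookup (f[xs]≤f[argmax] {f = f} a xs) (∈-filter⁺ P? (∈-allFin t) Pt)
  where
  xs : List (Fin n)
  xs = filter P? (allFin n)

module QuasiMedians {n} {d : Fin n → Fin n → ℕ} (isMetric : IsMetric _≡_ d) where
  open IsMetric isMetric using (triangle)
  open Intervals isMetric

  record Farthest (a b₁ b₂ : Fin n) : Set where
    field
      point   : Fin n
      ∈I₁     : I a b₁ point
      ∈I₂     : I a b₂ point
      maximal : ∀ t → I a b₁ t → I a b₂ t → d a t ≤ d a point

  farthest : ∀ a b₁ b₂ → Farthest a b₁ b₂
  farthest a b₁ b₂ =
    let c , (c∈I₁ , c∈I₂) , max = maximiser I? (d a) (I-start a b₁ , I-start a b₂)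
    in record { point = c ; ∈I₁ = c∈I₁ ; ∈I₂ = c∈I₂ ; maximal = λ t t∈I₁ t∈I₂ → max t (t∈I₁ , t∈I₂) }
    where
    I? : ∀ t → Dec (I a b₁ t × I a b₂ t)
    I? t = (d a t + d t b₁ ≟ d a b₁) ×-dec (d a t + d t b₂ ≟ d a b₂)

  record QuasiMedian (x y z : Fin n) : Set where
    field
      x' y' z'    : Fin n
      xy-split    : d x y ≡ d x x' + d x' y' + d y' y
      yz-split    : d y z ≡ d y y' + d y' z' + d z' z
      xz-split    : d x z ≡ d x x' + d x' z' + d z' z
      x'-isolated : ∀ t → I x' y' t → I x' z' t → t ≡ x'
      y'-isolated : ∀ t → I y' x' t → I y' z' t → t ≡ y'
      z'-isolated : ∀ t → I z' x' t → I z' y' t → t ≡ z'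

    x'∈I[x,y] : I x y x'
    x'∈I[x,y] = let x'∈I[x,y'] , y'∈I[x,y] = split⇒I xy-split in I-⊆ y'∈I[x,y] x'∈I[x,y']

    x'∈I[x,z] : I x z x'
    x'∈I[x,z] = let x'∈I[x,z'] , z'∈I[x,z] = split⇒I xz-split in I-⊆ z'∈I[x,z] x'∈I[x,z']

    y'∈I[y,x] : I y x y'
    y'∈I[y,x] = I-sym (proj₂ (split⇒I xy-split))

    y'∈I[y,z] : I y z y'
    y'∈I[y,z] = let y'∈I[y,z'] , z'∈I[y,z] = split⇒I yz-split in I-⊆ z'∈I[y,z] y'∈I[y,z']

    y'-detour : d x y' + d y' z ≤ d x z + (d x' y' + d y' z')
    y'-detour = begin
      d x y' + d y' z
        ≤⟨ +-mono-≤ (triangle x x' y') (triangle y' z' z) ⟩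
      (d x x' + d x' y') + (d y' z' + d z' z)
        ≡⟨ shuffle (d x x') (d x' y') (d y' z') (d z' z) ⟩
      (d x x' + d z' z) + (d x' y' + d y' z')
        ≤⟨ +-monoˡ-≤ (d x' y' + d y' z') (+-monoˡ-≤ (d z' z) (m≤m+n (d x x') (d x' z'))) ⟩
      (d x x' + d x' z' + d z' z) + (d x' y' + d y' z')
        ≡⟨ cong (_+ (d x' y' + d y' z')) (sym xz-split) ⟩
      d x z + (d x' y' + d y' z')
        ∎
      where
      open ≤-Reasoning
      shuffle : ∀ a b c e → (a + b) + (c + e) ≡ (a + e) + (b + c)
      shuffle = solve-∀

  quasiMedian : ∀ x y z → QuasiMedian x y z
  quasiMedian x y z = record
    { x' = x' ; y' = y' ; z' = z'
    ; xy-split = I-chain x'∈I[x,y] (I-sym y'∈I[y,x'])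
    ; yz-split = I-chain y'∈I[y,z] (I-sym z'∈I[z,y'])
    ; xz-split = I-chain x'∈I[x,z] (I-sym z'∈I[z,x'])
    ; x'-isolated = farthest-isolated (proj₁ xy) (proj₁ xz)
        (λ t t∈I₁ t∈I₂ → x'-maximal t (I-⊆ (proj₂ xy) t∈I₁) (I-⊆ (proj₂ xz) t∈I₂))
    ; y'-isolated = farthest-isolated y'∈I[y,x'] (proj₁ yz)
        (λ t t∈I₁ t∈I₂ → y'-maximal t t∈I₁ (I-⊆ (proj₂ yz) t∈I₂))
    ; z'-isolated = farthest-isolated z'∈I[z,x'] z'∈I[z,y'] z'-maximal
    }
    where
    open Farthest (farthest x y z)
      renaming (point to x'; ∈I₁ to x'∈I[x,y]; ∈I₂ to x'∈I[x,z]; maximal to x'-maximal)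
    open Farthest (farthest y x' z)
      renaming (point to y'; ∈I₁ to y'∈I[y,x']; ∈I₂ to y'∈I[y,z]; maximal to y'-maximal)
    open Farthest (farthest z x' y')
      renaming (point to z'; ∈I₁ to z'∈I[z,x']; ∈I₂ to z'∈I[z,y']; maximal to z'-maximal)
    xy : I x y' x' × I x y y'
    xy = I-trans x'∈I[x,y] (I-sym y'∈I[y,x'])
    xz : I x z' x' × I x z z'
    xz = I-trans x'∈I[x,z] (I-sym z'∈I[z,x'])
    yz : I y z' y' × I y z z'
    yz = I-trans y'∈I[y,z] (I-sym z'∈I[z,y'])

module BowMetricGraph (λ' μ q : ℕ) (G : Graph) (d : V G → V G → ℕ) (sp : IsShortestPathDist G d)
                      (bow : BowMetric G d λ' μ) (short : MetricTrianglesBounded G d q) where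
  open ShortestPath G d sp
  open Intervals isMetric
  open QuasiMedians isMetric
  open QuasiMedian
  open ≤-Reasoning

  M : ℕ
  M = μ ⊔ (q + 2 * λ')

  μ≤M : μ ≤ M
  μ≤M = m≤m⊔n μ (q + 2 * λ')

  q+2λ'≤M : q + 2 * λ' ≤ M
  q+2λ'≤M = m≤n⊔m μ (q + 2 * λ')

  2λ'≤M : 2 * λ' ≤ M
  2λ'≤M = ≤-trans (m≤n+m (2 * λ') q) q+2λ'≤M

  q≤M : q ≤ M
  q≤M = ≤-trans (m≤m+n q (2 * λ')) q+2λ'≤M

  short-sides : ∀ {x y z} (Q : QuasiMedian x y z) → d (x' Q) (y' Q) ≤ q × d (y' Q) (z' Q) ≤ q
  short-sides Q =
    let x'y'≤q , y'z'≤q , _ = short _ _ _ (x'-isolated Q , y'-isolated Q , z'-isolated Q) in x'y'≤q , y'z'≤q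

  corner-detour : ∀ {x y z} (Q : QuasiMedian x y z) → d x (y' Q) + d (y' Q) z ≤ d x z + 2 * q
  corner-detour {x} {z = z} Q = ≤-trans (y'-detour Q) (+-monoʳ-≤ (d x z) (begin
    d (x' Q) (y' Q) + d (y' Q) (z' Q)  ≤⟨ +-mono-≤ (proj₁ (short-sides Q)) (proj₂ (short-sides Q)) ⟩
    q + q                              ≡⟨ double q ⟩
    2 * q                              ∎))
    where
    double : ∀ n → n + n ≡ 2 * n
    double = solve-∀

  bow-through : ∀ {u v w x} → I u w v → I v x w → λ' < d v w → d u v + d v x ≤ d u x + μ
  bow-through {u} {v} {w} {x} v∈I w∈I λ'<vw = begin
    d u v + d v x            ≡⟨ cong (d u v +_) (sym w∈I) ⟩
    d u v + (d v w + d w x)  ≡⟨ sym (+-assoc (d u v) (d v w) (d w x)) ⟩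
    d u v + d v w + d w x    ≤⟨ bow u v w x v∈I w∈I λ'<vw ⟩
    d u x + μ                ∎

  far-corner⇒level-close : ∀ {w x p p' c} → I w x p → I w x p' → d w p ≡ d w p' →
                           I p p' c → I p w c → λ' < d p c → d p p' ≤ μ
  far-corner⇒level-close {x = x} {p} {p'} {c} p∈I p'∈I same c∈I[p,p'] c∈I[p,w] λ'<pc =
    +-cancelˡ-≤ (d x p) _ _ (begin
      d x p + d p p'  ≤⟨ bow-through p∈I[x,c] c∈I[p,p'] λ'<pc ⟩
      d x p' + μ      ≡⟨ cong (_+ μ) (sym (I-level p∈I p'∈I same)) ⟩
      d x p + μ       ∎)
    where
    p∈I[x,c] : I x c p
    p∈I[x,c] = proj₁ (I-trans (I-sym p∈I) c∈I[p,w])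

  near-corners⇒close : ∀ {x y z} (Q : QuasiMedian x y z) →
                       d x (x' Q) ≤ λ' → d y (y' Q) ≤ λ' → d x y ≤ M
  near-corners⇒close {x} {y} Q xx'≤λ' yy'≤λ' = begin
    d x y                                     ≡⟨ xy-split Q ⟩
    d x (x' Q) + d (x' Q) (y' Q) + d (y' Q) y ≤⟨ +-mono-≤ (+-mono-≤ xx'≤λ' (proj₁ (short-sides Q)))
                                                          (≤-trans (≤-reflexive (d-sym (y' Q) y)) yy'≤λ') ⟩
    λ' + q + λ'                               ≡⟨ rearrange λ' q ⟩
    q + 2 * λ'                                ≤⟨ q+2λ'≤M ⟩
    M                                         ∎
    where
    rearrange : ∀ l q → l + q + l ≡ q + 2 * l
    rearrange = solve-∀

  level-close : ∀ {w x p p'} → I w x p → I w x p' → d w p ≡ d w p' → d p p' ≤ M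
  level-close {w} {p = p} {p'} p∈I p'∈I same = by-corners (quasiMedian p p' w)
    where
    by-corners : QuasiMedian p p' w → d p p' ≤ M
    by-corners Q with λ' <? d p (x' Q) | λ' <? d p' (y' Q)
    ... | yes far | _ =
      ≤-trans (far-corner⇒level-close p∈I p'∈I same (x'∈I[x,y] Q) (x'∈I[x,z] Q) far) μ≤M
    ... | no _ | yes far' = begin
      d p p'  ≡⟨ d-sym p p' ⟩
      d p' p  ≤⟨ far-corner⇒level-close p'∈I p∈I (sym same) (y'∈I[y,x] Q) (y'∈I[y,z] Q) far' ⟩
      μ       ≤⟨ μ≤M ⟩
      M       ∎
    ... | no near | no near' = near-corners⇒close Q (≮⇒≥ near) (≮⇒≥ near')

  interval-detour : ∀ {w x a b} → I w x a → I w x b → d w a ≤ d w b → d w a + d a b ≤ d w b + M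
  interval-detour {w} {a = a} {b} a∈I b∈I wa≤wb with geodesic-point (geodesic w b) wa≤wb
  ... | c , _ , wc≡wa , c∈I[w,b] = begin
    d w a + d a b            ≤⟨ +-monoʳ-≤ (d w a) (d-triangle a c b) ⟩
    d w a + (d a c + d c b)  ≤⟨ +-monoʳ-≤ (d w a) (+-monoˡ-≤ (d c b) ac≤M) ⟩
    d w a + (M + d c b)      ≡⟨ cong (_+ (M + d c b)) (sym wc≡wa) ⟩
    d w c + (M + d c b)      ≡⟨ rearrange (d w c) M (d c b) ⟩
    d w c + d c b + M        ≡⟨ cong (_+ M) c∈I[w,b] ⟩
    d w b + M                ∎
    where
    ac≤M : d a c ≤ M
    ac≤M = level-close a∈I (I-⊆ b∈I c∈I[w,b]) (sym wc≡wa)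
    rearrange : ∀ a m b → a + (m + b) ≡ a + b + m
    rearrange = solve-∀

  four-point-ordered : ∀ {u v w x} (Q₁ : QuasiMedian u w x) (Q₂ : QuasiMedian v w x) →
                       d w (y' Q₁) ≤ d w (y' Q₂) → d u v + d w x ≤ d u x + d v w + (M + 2 * q)
  four-point-ordered {u} {v} {w} {x} Q₁ Q₂ w₁≤w₂ = begin
    d u v + d w x
      ≤⟨ +-monoˡ-≤ (d w x) uv≤ ⟩
    d u w₁ + (d w₁ w₂ + d w₂ v) + d w x
      ≡⟨ cong (d u w₁ + (d w₁ w₂ + d w₂ v) +_) (sym w₁∈I[w,x]) ⟩
    d u w₁ + (d w₁ w₂ + d w₂ v) + (d w w₁ + d w₁ x)
      ≡⟨ shuffle (d u w₁) (d w₁ w₂) (d w₂ v) (d w w₁) (d w₁ x) ⟩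
    (d u w₁ + d w₁ x) + (d w w₁ + d w₁ w₂) + d w₂ v
      ≤⟨ +-monoˡ-≤ (d w₂ v) (+-mono-≤ (corner-detour Q₁) w₁w₂≤) ⟩
    (d u x + 2 * q) + (d w w₂ + M) + d w₂ v
      ≡⟨ shuffle′ (d u x) (2 * q) (d w w₂) M (d w₂ v) ⟩
    d u x + (d w w₂ + d w₂ v) + (M + 2 * q)
      ≡⟨ cong (λ s → d u x + s + (M + 2 * q)) wv≡vw ⟩
    d u x + d v w + (M + 2 * q)
      ∎
    where
    w₁ w₂ : V G
    w₁ = y' Q₁
    w₂ = y' Q₂
    w₁∈I[w,x] : I w x w₁
    w₁∈I[w,x] = y'∈I[y,z] Q₁
    uv≤ : d u v ≤ d u w₁ + (d w₁ w₂ + d w₂ v)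
    uv≤ = ≤-trans (d-triangle u w₁ v) (+-monoʳ-≤ (d u w₁) (d-triangle w₁ w₂ v))
    w₁w₂≤ : d w w₁ + d w₁ w₂ ≤ d w w₂ + M
    w₁w₂≤ = interval-detour w₁∈I[w,x] (y'∈I[y,z] Q₂) w₁≤w₂
    wv≡vw : d w w₂ + d w₂ v ≡ d v w
    wv≡vw = trans (y'∈I[y,x] Q₂) (d-sym w v)
    shuffle : ∀ a b c e f → a + (b + c) + (e + f) ≡ (a + f) + (e + b) + c
    shuffle = solve-∀
    shuffle′ : ∀ a b c e f → (a + b) + (c + e) + f ≡ a + (c + f) + (e + b)
    shuffle′ = solve-∀

  four-point : ∀ u v w x → d u v + d w x ≤ (d u w + d v x) ⊔ (d u x + d v w) + (M + 2 * q)
  four-point u v w x = by-order (quasiMedian u w x) (quasiMedian v w x)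
    where
    bound : ℕ
    bound = (d u w + d v x) ⊔ (d u x + d v w) + (M + 2 * q)
    by-order : QuasiMedian u w x → QuasiMedian v w x → d u v + d w x ≤ bound
    by-order Qᵤ Qᵥ with ≤-total (d w (y' Qᵤ)) (d w (y' Qᵥ))
    ... | inj₁ w₁≤w₂ = begin
      d u v + d w x                ≤⟨ four-point-ordered Qᵤ Qᵥ w₁≤w₂ ⟩
      d u x + d v w + (M + 2 * q)  ≤⟨ +-monoˡ-≤ (M + 2 * q) (m≤n⊔m (d u w + d v x) (d u x + d v w)) ⟩
      bound                        ∎
    ... | inj₂ w₂≤w₁ = begin
      d u v + d w x                ≡⟨ cong (_+ d w x) (d-sym u v) ⟩
      d v u + d w x                ≤⟨ four-point-ordered Qᵥ Qᵤ w₂≤w₁ ⟩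
      d v x + d u w + (M + 2 * q)  ≡⟨ cong (_+ (M + 2 * q)) (+-comm (d v x) (d u w)) ⟩
      d u w + d v x + (M + 2 * q)  ≤⟨ +-monoˡ-≤ (M + 2 * q) (m≤m⊔n (d u w + d v x) (d u x + d v w)) ⟩
      bound                        ∎

  hyperbolic : HyperbolicTwice G d (M + 2 * q)
  hyperbolic = four-point⇒HyperbolicTwice G d d-sym four-point

  2*-triangle : ∀ a b c → 2 * d a c ≤ 2 * d a b + 2 * d b c
  2*-triangle a b c =
    ≤-trans (*-monoʳ-≤ 2 (d-triangle a b c)) (≤-reflexive (*-distribˡ-+ 2 (d a b) (d b c)))

  far-corner⇒pinched : ∀ {u v w p p₁ p₂} → I u v p → I p u p₁ → I p w p₁ → λ' < d p p₁ →
                       I p v p₂ → I p w p₂ → 2 * d p p₂ ≤ μ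
  far-corner⇒pinched {u} {w = w} {p} {p₁} {p₂} p∈I p₁∈I[p,u] p₁∈I[p,w] λ'<pp₁ p₂∈I[p,v] p₂∈I[p,w] =
    +-cancelʳ-≤ (d p₂ w) _ _ (begin
      2 * d p p₂ + d p₂ w           ≡⟨ rearrange (d p p₂) (d p₂ w) ⟩
      d p p₂ + (d p p₂ + d p₂ w)    ≡⟨ cong₂ _+_ (d-sym p p₂) p₂∈I[p,w] ⟩
      d p₂ p + d p w                ≤⟨ bow-through p∈I[p₂,p₁] p₁∈I[p,w] λ'<pp₁ ⟩
      d p₂ w + μ                    ≡⟨ +-comm (d p₂ w) μ ⟩
      μ + d p₂ w                    ∎)
    where
    p∈I[u,p₂] : I u p₂ p
    p∈I[u,p₂] = proj₁ (I-trans p∈I p₂∈I[p,v])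
    p∈I[p₂,p₁] : I p₂ p₁ p
    p∈I[p₂,p₁] = proj₁ (I-trans (I-sym p∈I[u,p₂]) p₁∈I[p,u])
    rearrange : ∀ a b → 2 * a + b ≡ a + (a + b)
    rearrange = solve-∀

  close-corner : ∀ {u v} w {p} → I u v p → ∃[ c ] (I v w c ⊎ I w u c) × 2 * d p c ≤ M + 2 * q
  close-corner {u} {v} w {p} p∈I = by-corners (quasiMedian p u w) (quasiMedian p v w)
    where
    via : ∀ {m c} → 2 * d p m ≤ M → d m c ≤ q → 2 * d p c ≤ M + 2 * q
    via {m} {c} pm mc = ≤-trans (2*-triangle p m c) (+-mono-≤ pm (*-monoʳ-≤ 2 mc))
    by-corners : QuasiMedian p u w → QuasiMedian p v w →
                 ∃[ c ] (I v w c ⊎ I w u c) × 2 * d p c ≤ M + 2 * q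
    by-corners Qᵤ Qᵥ with λ' <? d p (x' Qᵤ)
    ... | yes far = y' Qᵥ , inj₁ (y'∈I[y,z] Qᵥ) , via (≤-trans pinched μ≤M) (proj₁ (short-sides Qᵥ))
      where
      pinched : 2 * d p (x' Qᵥ) ≤ μ
      pinched = far-corner⇒pinched p∈I (x'∈I[x,y] Qᵤ) (x'∈I[x,z] Qᵤ) far (x'∈I[x,y] Qᵥ) (x'∈I[x,z] Qᵥ)
    ... | no near = y' Qᵤ , inj₂ (I-sym (y'∈I[y,z] Qᵤ)) ,
      via (≤-trans (*-monoʳ-≤ 2 (≮⇒≥ near)) 2λ'≤M) (proj₁ (short-sides Qᵤ))

  near-geodesic : ∀ {a b c} (P : Geodesic G d a b) → I a b c → ∃[ y ] OnPath G d P y × d c y ≤ M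
  near-geodesic P c∈I with geodesic-point P (I⇒≤ c∈I)
  ... | y , y∈P , ay≡ac , y∈I = y , y∈P , level-close c∈I y∈I (sym ay≡ac)

  corner-relay : ∀ {p c y} → 2 * d p c ≤ M + 2 * q → d c y ≤ M → 2 * d p y ≤ 3 * M + 2 * q
  corner-relay {p} {c} {y} pc cy = begin
    2 * d p y              ≤⟨ 2*-triangle p c y ⟩
    2 * d p c + 2 * d c y  ≤⟨ +-mono-≤ pc (*-monoʳ-≤ 2 cy) ⟩
    M + 2 * q + 2 * M      ≡⟨ rearrange M q ⟩
    3 * M + 2 * q          ∎
    where
    rearrange : ∀ m q → m + 2 * q + 2 * m ≡ 3 * m + 2 * q
    rearrange = solve-∀

  slim-side : ∀ {u v w} (P : Geodesic G d u v) (Q : Geodesic G d v w) (R : Geodesic G d w u) →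
              SideCloseTwice G d (3 * M + 2 * q) P Q R
  slim-side {w = w} P Q R i with close-corner w (proj₂ (geodesic-vertex P i))
  ... | c , inj₁ c∈I[v,w] , pc =
    let y , y∈Q , cy = near-geodesic Q c∈I[v,w] in y , inj₁ y∈Q , corner-relay pc cy
  ... | c , inj₂ c∈I[w,u] , pc =
    let y , y∈R , cy = near-geodesic R c∈I[w,u] in y , inj₂ y∈R , corner-relay pc cy

  slim : SlimTwice G d (3 * M + 2 * q)
  slim u v w P Q R = slim-side P Q R , slim-side Q R P , slim-side R P Q

  hyperbolicity-bound : M + 2 * q ≤ (M + 4 * q) ⊓ (8 * M + 2 * q + 1)
  hyperbolicity-bound = ⊓-glb (+-monoʳ-≤ M (*-monoˡ-≤ q (m≤m+n 2 2)))
                              (≤-trans (+-monoˡ-≤ (2 * q) (m≤n*m M 8)) (m≤m+n (8 * M + 2 * q) 1))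

  slimness-bound : 3 * M + 2 * q ≤ (3 * M + 12 * q + 1) ⊓ (4 * M + q)
  slimness-bound =
    ⊓-glb (≤-trans (+-monoʳ-≤ (3 * M) (*-monoˡ-≤ q (m≤m+n 2 10))) (m≤m+n (3 * M + 12 * q) 1)) (begin
      3 * M + 2 * q  ≡⟨ split-q M q ⟩
      3 * M + q + q  ≤⟨ +-monoʳ-≤ (3 * M + q) q≤M ⟩
      3 * M + q + M  ≡⟨ collect-M M q ⟩
      4 * M + q      ∎)
    where
    split-q : ∀ m q → 3 * m + 2 * q ≡ 3 * m + q + q
    split-q = solve-∀
    collect-M : ∀ m q → 3 * m + q + m ≡ 4 * m + q
    collect-M = solve-∀

theorem1 : (λ' μ q : ℕ) (G : Graph) (d : V G → V G → ℕ) →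
    Connected G → IsShortestPathDist G d →
    BowMetric G d λ' μ → MetricTrianglesBounded G d q →
    HyperbolicTwice G d (((μ ⊔ (q + 2 * λ')) + 4 * q) ⊓ (8 * (μ ⊔ (q + 2 * λ')) + 2 * q + 1)) ×
    SlimTwice G d ((3 * (μ ⊔ (q + 2 * λ')) + 12 * q + 1) ⊓ (4 * (μ ⊔ (q + 2 * λ')) + q))
theorem1 λ' μ q G d _ sp bow short =
  HyperbolicTwice-mono G d hyperbolicity-bound hyperbolic , SlimTwice-mono G d slimness-bound slim
  where open BowMetricGraph λ' μ q G d sp bow short
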